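{- If $(\mathsf{e},\gamma)$ is an actual event, then $\Phi(\mathsf{e})\circ\gamma$ is a Bishop real.
   Context: Constructive (Bishop-style) setting. A potential event is a sequence $\mathsf{e}:\mathbb{N}^{+}\to\{0,1\}$. For a potential event define $\Phi(\mathsf{e})(n)=\frac{\sum_{i=1}^{n}\mathsf{e}(i)}{n}$ for $n\in\mathbb{N}^{+}$. An actual event is a pair $(\mathsf{e},\gamma)$ with $\mathsf{e}$ a potential event and $\gamma:\mathbb{N}^{+}\to\mathbb{N}^{+}$ strictly increasing, such that $|\Phi(\mathsf{e})(\gamma(n)+i)-\Phi(\mathsf{e})(\gamma(n)+j)|\le\frac1n$ for all $n\in\mathbb{N}^{+}$, $i,j\in\mathbb{N}$. A Bishop real is a sequence $x:\mathbb{N}^{+}\to\mathbb{Q}$ with $|x(n)-x(m)|\le\frac1n+\frac1m$ for all $n,m\in\mathbb{N}^{+}$. -}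

module Defs where

open import Data.Nat as ℕ using (ℕ; zero; suc; NonZero)
open import Data.Integer using (+_)
open import Data.Rational using (ℚ; _-_; _+_; _≤_; ∣_∣; _/_)
open import Data.Bool using (Bool; true; false)
open import Data.Product using (Σ; _×_)

record ℕ⁺ : Set where
  constructor ⟨_⟩
  field
    val : ℕ
    {{nz}} : NonZero val
open ℕ⁺ public

-- {0,1} encoded by Bool (true = 1, false = 0)
bit : Bool → ℕ
bit true  = 1
bit false = 0

PotentialEvent : Set
PotentialEvent = ℕ⁺ → Bool

sumTo : PotentialEvent → ℕ → ℕ
sumTo e zero    = 0
sumTo e (suc n) = sumTo e n ℕ.+ bit (e ⟨ suc n ⟩)

Φ : PotentialEvent → ℕ⁺ → ℚ
Φ e n = (+ sumTo e (val n)) / val n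

inv : ℕ⁺ → ℚ
inv n = (+ 1) / val n

_+ᵖ_ : ℕ⁺ → ℕ → ℕ⁺
⟨ suc k ⟩ +ᵖ i = ⟨ suc (k ℕ.+ i) ⟩

StrictlyIncreasing : (ℕ⁺ → ℕ⁺) → Set
StrictlyIncreasing γ = ∀ (m n : ℕ⁺) → val m ℕ.< val n → val (γ m) ℕ.< val (γ n)

IsActualEvent : PotentialEvent → (ℕ⁺ → ℕ⁺) → Set
IsActualEvent e γ =
  StrictlyIncreasing γ ×
  (∀ (n : ℕ⁺) (i j : ℕ) → ∣ Φ e (γ n +ᵖ i) - Φ e (γ n +ᵖ j) ∣ ≤ inv n)

IsBishopReal : (ℕ⁺ → ℚ) → Set
IsBishopReal x = ∀ (n m : ℕ⁺) → ∣ x n - x m ∣ ≤ inv n + inv m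

-- Φ e is constant up to 1/n from position γ n onward, so for n ≤ m the values
-- Φ e (γ n) and Φ e (γ m) (with γ n ≤ γ m by monotonicity) differ by at most
-- 1/n ≤ 1/n + 1/m; the case m ≤ n is symmetric.
module Submission where

open import Defs
open import Function using (_∘_)
open import Data.Nat as ℕ using (suc)
import Data.Nat.Properties as ℕ
open import Data.Rational using (ℚ; _-_; _+_; _≤_; ∣_∣; 0ℚ)
open import Data.Rational.Properties
  using ( ≤-trans; +-monoʳ-≤; +-identityʳ; +-comm; +-0-group; ∣-p∣≡∣p∣
        ; nonNegative⁻¹; normalize-nonNeg; module ≤-Reasoning)
open import Data.Product using (_,_)
open import Data.Sum using (inj₁; inj₂; [_,_]′)
open import Relation.Binary.PropositionalEquality
  using (_≡_; refl; sym; trans; cong; subst; subst₂)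
open import Algebra.Properties.Group +-0-group using (⁻¹-anti-homo-//)

val-injective : ∀ {p q : ℕ⁺} → val p ≡ val q → p ≡ q
val-injective {⟨ suc k ⟩} {⟨ suc .k ⟩} refl = refl

val-+ᵖ : ∀ (p : ℕ⁺) i → val (p +ᵖ i) ≡ val p ℕ.+ i
val-+ᵖ ⟨ suc k ⟩ i = refl

StrictlyIncreasing⇒monotone : ∀ γ → StrictlyIncreasing γ →
                              ∀ {n m} → val n ℕ.≤ val m → val (γ n) ℕ.≤ val (γ m)
StrictlyIncreasing⇒monotone γ γ-inc {n} {m} n≤m with ℕ.m≤n⇒m<n∨m≡n n≤m
... | inj₁ n<m = ℕ.<⇒≤ (γ-inc n m n<m)
... | inj₂ n≡m = ℕ.≤-reflexive (cong (val ∘ γ) (val-injective n≡m))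

inv-nonNeg : ∀ n → 0ℚ ≤ inv n
inv-nonNeg ⟨ suc k ⟩ = nonNegative⁻¹ _ {{normalize-nonNeg 1 (suc k)}}

p≤p+q : ∀ p {q} → 0ℚ ≤ q → p ≤ p + q
p≤p+q p 0≤q = subst (_≤ p + _) (+-identityʳ p) (+-monoʳ-≤ p 0≤q)

p≤q+p : ∀ p {q} → 0ℚ ≤ q → p ≤ q + p
p≤q+p p {q} 0≤q = subst (p ≤_) (+-comm p q) (p≤p+q p 0≤q)

∣p-q∣≡∣q-p∣ : ∀ p q → ∣ p - q ∣ ≡ ∣ q - p ∣
∣p-q∣≡∣q-p∣ p q = trans (sym (∣-p∣≡∣p∣ (p - q))) (cong ∣_∣ (⁻¹-anti-homo-// p q))

tail-oscillation⇒close : ∀ (f : ℕ⁺ → ℚ) {p q : ℕ⁺} {ε} →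
                         (∀ i j → ∣ f (p +ᵖ i) - f (p +ᵖ j) ∣ ≤ ε) →
                         val p ℕ.≤ val q → ∣ f p - f q ∣ ≤ ε
tail-oscillation⇒close f {p} {q} osc p≤q =
  subst₂ (λ a b → ∣ a - b ∣ ≤ _) (cong f p+ᵖ0≡p) (cong f p+ᵖd≡q) (osc 0 d)
  where
  d = val q ℕ.∸ val p
  p+ᵖ0≡p : p +ᵖ 0 ≡ p
  p+ᵖ0≡p = val-injective (trans (val-+ᵖ p 0) (ℕ.+-identityʳ (val p)))
  p+ᵖd≡q : p +ᵖ d ≡ q
  p+ᵖd≡q = val-injective (trans (val-+ᵖ p d) (ℕ.m+[n∸m]≡n p≤q))

oneSided⇒IsBishopReal : ∀ (x : ℕ⁺ → ℚ) →
                        (∀ {n m} → val n ℕ.≤ val m → ∣ x n - x m ∣ ≤ inv n) →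
                        IsBishopReal x
oneSided⇒IsBishopReal x close n m = [ n≤m-case , m≤n-case ]′ (ℕ.≤-total (val n) (val m))
  where
  open ≤-Reasoning
  n≤m-case : val n ℕ.≤ val m → ∣ x n - x m ∣ ≤ inv n + inv m
  n≤m-case n≤m = ≤-trans (close n≤m) (p≤p+q (inv n) (inv-nonNeg m))
  m≤n-case : val m ℕ.≤ val n → ∣ x n - x m ∣ ≤ inv n + inv m
  m≤n-case m≤n = begin
    ∣ x n - x m ∣  ≡⟨ ∣p-q∣≡∣q-p∣ (x n) (x m) ⟩
    ∣ x m - x n ∣  ≤⟨ close m≤n ⟩
    inv m          ≤⟨ p≤q+p (inv m) (inv-nonNeg n) ⟩
    inv n + inv m  ∎

mainTheorem3 : (e : PotentialEvent) (γ : ℕ⁺ → ℕ⁺) → IsActualEvent e γ → IsBishopReal (Φ e ∘ γ)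
mainTheorem3 e γ (γ-inc , settles) =
  oneSided⇒IsBishopReal (Φ e ∘ γ) λ {n} {m} n≤m →
    tail-oscillation⇒close (Φ e) {γ n} {γ m} (settles n)
      (StrictlyIncreasing⇒monotone γ γ-inc n≤m)
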